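{- (1) For every $i\ge1$, $\pi\partial_i(1)=\delta_i\pi(1)$. (2) Let $k\ge1$, $(s_1,\dots,s_k)\in\mathbb Z_{\ge1}^k$, $\ell_1,\dots,\ell_k\in\mathbb Z_{\ge1}$ pairwise distinct, and $i\ge1$, where if $i>k$ the index $\ell_i$ is any positive integer not in $\{\ell_1,\dots,\ell_k\}$. Then $\pi\partial_{\ell_i}\big(\Phi^{s_1,\dots,s_k}_{\ell_1,\dots,\ell_k}\big)=\delta_i\pi\big(\Phi^{s_1,\dots,s_k}_{\ell_1,\dots,\ell_k}\big)$.
   Context: Let $\{x_i\}_{i\ge1}$ be variables. For $k\ge1$, distinct $i_1,\dots,i_k\in\mathbb Z_{\ge1}$ and $(s_1,\dots,s_k)\in\mathbb Z_{\ge1}^k$, the Chen fraction is $\Phi^{s_1,\dots,s_k}_{i_1,\dots,i_k}:=\frac{1}{(x_{i_1}+\dots+x_{i_k})^{s_1}(x_{i_2}+\dots+x_{i_k})^{s_2}\cdots x_{i_k}^{s_k}}$. Let $F^{ch}$ be the set of Chen fractions together with $1$, and $\mathbb Q F^{ch}$ its span, in which $F^{ch}$ is a basis; $\partial_i:=-\frac{\partial}{\partial x_i}$. Let $\mathcal H$ be the $\mathbb Q$-vector space with basis a symbol $\mathbf 1$ and symbols $[s_1,\dots,s_k]$, $k\ge1$, $s_j\in\mathbb Z_{\ge1}$; $\pi:\mathbb Q F^{ch}\to\mathcal H$ is linear with $\pi(1)=\mathbf 1$, $\pi(\Phi^{s_1,\dots,s_k}_{i_1,\dots,i_k})=[s_1,\dots,s_k]$.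 For $i\ge1$, $\delta_i:\mathcal H\to\mathcal H$ is linear with $\delta_i(\mathbf 1)=0$ and $\delta_i[s_1,\dots,s_k]=\sum_{j=1}^i s_j[s_1,\dots,s_j+1,\dots,s_k]$ if $i\le k$, $=0$ if $i>k$. -}

module Defs where

open import Data.Nat as ℕ using (ℕ; zero; suc; _≤_; _<_; _≤?_)
open import Data.Integer using (+_)
open import Data.Rational as ℚ using (ℚ; 0ℚ; 1ℚ; _/_)
open import Data.List using (List; []; _∷_; _++_; map; concatMap; length; filter; foldr)
open import Data.List.Properties as LP using ()
open import Data.Product using (_×_; _,_; Σ)
open import Data.Product.Properties as PP using ()
open import Data.Vec using (Vec; toList; lookup)
open import Data.Fin using (Fin; toℕ)
open import Data.Unit using (⊤)
open import Data.Sum using (_⊎_)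
open import Relation.Nullary using (yes; no; ¬_)
open import Relation.Binary.PropositionalEquality using (_≡_)
open import Data.List.Relation.Unary.All using (All)
open import Data.List.Relation.Unary.Unique.Propositional using (Unique)
open import Data.List.Membership.Propositional using (_∈_)

ι : ℕ → ℚ
ι n = + n / 1

-- Formal rational functions in the variables x₁, x₂, …
-- A linear form  L_S = Σ_{j ∈ S} x_j  is given by the list S of indices.
-- A monomial  Π_p L_{S_p}^{-e_p}  is the list of pairs (S_p , e_p).

LinForm : Set
LinForm = List ℕ

Mono : Set
Mono = List (LinForm × ℕ)

MComb : Set
MComb = List (ℚ × Mono)

coeffVar : ℕ → LinForm → ℕ
coeffVar m S = length (filter (ℕ._≟ m) S)

-- ∂_m = - ∂/∂x_m on a monomial, via the Leibniz rule and
-- -∂/∂x_m (L^{-e}) = e · (coeff of x_m in L) · L^{-(e+1)}.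
∂mono : ℕ → Mono → MComb
∂mono m [] = []
∂mono m ((S , e) ∷ fs) =
  (ι (e ℕ.* coeffVar m S) , (S , suc e) ∷ fs)
  ∷ map (λ { (c , t) → (c , (S , e) ∷ t) }) (∂mono m fs)

∂ : ℕ → MComb → MComb
∂ m = concatMap (λ { (c , mo) → map (λ { (d , mo') → (c ℚ.* d , mo') }) (∂mono m mo) })

coeffM : MComb → Mono → ℚ
coeffM [] mo = 0ℚ
coeffM ((c , mo') ∷ xs) mo with LP.≡-dec (PP.≡-dec (LP.≡-dec ℕ._≟_) ℕ._≟_) mo' mo
... | yes _ = c ℚ.+ coeffM xs mo
... | no  _ = coeffM xs mo

_≈M_ : MComb → MComb → Set
x ≈M y = ∀ mo → coeffM x mo ≡ coeffM y mo

-- Φ^{s₁…s_k}_{ℓ₁…ℓ_k} = Π_j (x_{ℓ_j}+…+x_{ℓ_k})^{-s_j}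
chenMono : List ℕ → List ℕ → Mono
chenMono (l ∷ ls) (s ∷ ss) = (l ∷ ls , s) ∷ chenMono ls ss
chenMono _ _ = []

data Fch : Set where
  one  : Fch
  chen : (n : ℕ) → (ls ss : Vec ℕ (suc n)) → Fch

ValidF : Fch → Set
ValidF one = ⊤
ValidF (chen n ls ss) =
  Unique (toList ls) × All (1 ≤_) (toList ls) × All (1 ≤_) (toList ss)

monoOf : Fch → Mono
monoOf one = []
monoOf (chen n ls ss) = chenMono (toList ls) (toList ss)

FComb : Set
FComb = List (ℚ × Fch)

embed : FComb → MComb
embed = map (λ { (c , f) → (c , monoOf f) })

-- The space ℋ.  Basis symbols are lists of positive integers:
-- [] stands for the symbol 𝟏 and (s₁ ∷ … ∷ s_k ∷ []) for [s₁,…,s_k].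

HComb : Set
HComb = List (ℚ × List ℕ)

coeffH : HComb → List ℕ → ℚ
coeffH [] b = 0ℚ
coeffH ((c , b') ∷ xs) b with LP.≡-dec ℕ._≟_ b' b
... | yes _ = c ℚ.+ coeffH xs b
... | no  _ = coeffH xs b

_≈H_ : HComb → HComb → Set
x ≈H y = ∀ b → coeffH x b ≡ coeffH y b

πF : Fch → List ℕ
πF one = []
πF (chen n ls ss) = toList ss

π : FComb → HComb
π = map (λ { (c , f) → (c , πF f) })

bumps : ℕ → List ℕ → HComb
bumps zero ss = []
bumps (suc i) [] = []
bumps (suc i) (s ∷ ss) =
  (ι s , suc s ∷ ss) ∷ map (λ { (c , t) → (c , s ∷ t) }) (bumps i ss)

-- δ_i on basis symbols: zero if i > k (in particular δ_i 𝟏 = 0 for i ≥ 1)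
δB : ℕ → List ℕ → HComb
δB i ss with i ≤? length ss
... | yes _ = bumps i ss
... | no  _ = []

δ : ℕ → HComb → HComb
δ i = concatMap (λ { (c , b) → map (λ { (d , b') → (c ℚ.* d , b') }) (δB i b) })

-- "the element ∂X of ℚF^ch satisfies π(∂X) = δ_i(πX)":
-- some combination c of (well-formed) elements of F^ch equals ∂_m X, and π c = δ_i (π X).
πDerivEq : ℕ → ℕ → FComb → Set
πDerivEq m i X =
  Σ FComb λ c → All (λ p → ValidF (Data.Product.proj₂ p)) c
              × (embed c ≈M ∂ m (embed X))
              × (π c ≈H δ i (π X))

IndexSpec : {k : ℕ} → Vec ℕ k → ℕ → ℕ → Set
IndexSpec {k} ls i m =
  (Σ (Fin k) λ j → (suc (toℕ j) ≡ i) × (m ≡ lookup ls j))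
  ⊎ (k < i × 1 ≤ m × ¬ (m ∈ toList ls))

{-# OPTIONS --safe #-}
-- By the Leibniz rule, ∂_m Φ^{s₁…s_k}_{ℓ₁…ℓ_k} is the sum over j of s_j · (coefficient of x_m
-- in L_j = x_{ℓ_j} + ⋯ + x_{ℓ_k}) times Φ with s_j raised by one. As the ℓ's are distinct,
-- x_{ℓ_i} occurs, exactly once, in L₁, …, L_i and in no later L_j, so the surviving terms are
-- s_j Φ^{…,s_j+1,…}_{ℓ₁…ℓ_k} for j ≤ i, whose image under π is δ_i[s₁,…,s_k]. When m is not
-- among the ℓ's every coefficient vanishes, matching δ_i = 0 for i > k.
module Submission where

open import Defs
open import Data.Nat as ℕ using (ℕ; zero; suc; _≤_; _<_; _≤?_)
open import Data.Nat.Properties using (*-identityʳ; *-zeroʳ; <⇒≱)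
open import Data.Rational using (ℚ; 0ℚ; 1ℚ; _+_; _*_)
open import Data.Rational.Properties using (+-identityˡ; +-identityʳ; +-assoc; *-identityˡ)
open import Data.Vec using (Vec; []; _∷_; toList; lookup)
open import Data.Vec.Properties using (length-toList)
open import Data.Vec.Membership.Propositional.Properties using (∈-lookup; ∈-toList⁺)
open import Data.Fin as Fin using (Fin; toℕ)
open import Data.Fin.Properties using (toℕ<n)
open import Data.List using (List; []; _∷_; _++_; map; length)
open import Data.List.Properties as List using (map-∘; map-++; map-cong; map-id; ++-identityʳ; filter-accept; filter-reject)
open import Data.List.Relation.Unary.All as All using (All; []; _∷_)
open import Data.List.Relation.Unary.All.Properties using (map⁺; All¬⇒¬Any)
open import Data.List.Relation.Unary.AllPairs using (_∷_)
open import Data.List.Relation.Unary.Any using (here; there)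
open import Data.List.Relation.Unary.Unique.Propositional using (Unique)
open import Data.List.Membership.Propositional using (_∈_; _∉_)
open import Data.Product using (_×_; _,_; proj₁; proj₂; ∃; map₂)
import Data.Product.Properties as Product
open import Data.Sum using (inj₁; inj₂)
open import Function using (_∘_)
open import Relation.Nullary using (yes; no; ¬_; contradiction)
open import Relation.Binary.PropositionalEquality using (_≡_; refl; sym; trans; cong; cong₂; subst; module ≡-Reasoning)
open import Relation.Binary.Definitions using (DecidableEquality)
open ≡-Reasoning

-- The decision procedure inside coeffM, so that `with` on it unfolds coeffM.
_≟ᴹ_ : DecidableEquality Mono
_≟ᴹ_ = List.≡-dec (Product.≡-dec (List.≡-dec ℕ._≟_) ℕ._≟_)

prefixAll : ∀ {A : Set} → A → List (ℚ × List A) → List (ℚ × List A)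
prefixAll x = map (map₂ (x ∷_))

coeffM-++ : ∀ xs ys mo → coeffM (xs ++ ys) mo ≡ coeffM xs mo + coeffM ys mo
coeffM-++ [] ys mo = sym (+-identityˡ (coeffM ys mo))
coeffM-++ ((c , mo′) ∷ xs) ys mo with mo′ ≟ᴹ mo
... | yes _ = trans (cong (c +_) (coeffM-++ xs ys mo)) (sym (+-assoc c _ _))
... | no _ = coeffM-++ xs ys mo

ZeroCoeffs : MComb → Set
ZeroCoeffs = All ((_≡ 0ℚ) ∘ proj₁)

coeffM-ZeroCoeffs : ∀ {zs} → ZeroCoeffs zs → ∀ mo → coeffM zs mo ≡ 0ℚ
coeffM-ZeroCoeffs [] mo = refl
coeffM-ZeroCoeffs {(c , mo′) ∷ zs} (refl ∷ zs-zero) mo with mo′ ≟ᴹ mo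
... | yes _ = trans (+-identityˡ _) (coeffM-ZeroCoeffs zs-zero mo)
... | no _ = coeffM-ZeroCoeffs zs-zero mo

++-ZeroCoeffs-≈M : ∀ xs {zs} → ZeroCoeffs zs → (xs ++ zs) ≈M xs
++-ZeroCoeffs-≈M xs {zs} zs-zero mo = begin
  coeffM (xs ++ zs) mo           ≡⟨ coeffM-++ xs zs mo ⟩
  coeffM xs mo + coeffM zs mo    ≡⟨ cong (coeffM xs mo +_) (coeffM-ZeroCoeffs zs-zero mo) ⟩
  coeffM xs mo + 0ℚ              ≡⟨ +-identityʳ _ ⟩
  coeffM xs mo                   ∎

ZeroCoeffs-prefixAll : ∀ x {zs} → ZeroCoeffs zs → ZeroCoeffs (prefixAll x zs)
ZeroCoeffs-prefixAll x zs-zero = map⁺ zs-zero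

map-1ℚ*-++-[] : ∀ {A : Set} (xs : List (ℚ × A)) → map (λ p → (1ℚ * proj₁ p , proj₂ p)) xs ++ [] ≡ xs
map-1ℚ*-++-[] xs = begin
  map (λ p → (1ℚ * proj₁ p , proj₂ p)) xs ++ []   ≡⟨ ++-identityʳ _ ⟩
  map (λ p → (1ℚ * proj₁ p , proj₂ p)) xs         ≡⟨ map-cong (λ p → cong (_, proj₂ p) (*-identityˡ (proj₁ p))) xs ⟩
  map (λ p → p) xs                                ≡⟨ map-id xs ⟩
  xs                                              ∎

∂-1ℚ : ∀ m mo → ∂ m ((1ℚ , mo) ∷ []) ≡ ∂mono m mo
∂-1ℚ m mo = map-1ℚ*-++-[] (∂mono m mo)

δ-1ℚ : ∀ i b → δ i ((1ℚ , b) ∷ []) ≡ δB i b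
δ-1ℚ i b = map-1ℚ*-++-[] (δB i b)

δB-≤ : ∀ {i} b → i ≤ length b → δB i b ≡ bumps i b
δB-≤ {i} b i≤k with i ≤? length b
... | yes _ = refl
... | no i≰k = contradiction i≤k i≰k

δB-≰ : ∀ {i} b → ¬ i ≤ length b → δB i b ≡ []
δB-≰ {i} b i≰k with i ≤? length b
... | yes i≤k = contradiction i≤k i≰k
... | no _ = refl

coeffVar-∉ : ∀ {m} S → m ∉ S → coeffVar m S ≡ 0
coeffVar-∉ [] m∉S = refl
coeffVar-∉ {m} (l ∷ S) m∉l∷S = trans (cong length (filter-reject (ℕ._≟ m) (m∉l∷S ∘ here ∘ sym)))
                                      (coeffVar-∉ S (m∉l∷S ∘ there))

coeffVar-∈-Unique : ∀ {m} S → Unique S → m ∈ S → coeffVar m S ≡ 1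
coeffVar-∈-Unique {m} (m ∷ S) (m∉S ∷ _) (here refl) =
  trans (cong length (filter-accept (ℕ._≟ m) refl)) (cong suc (coeffVar-∉ S (All¬⇒¬Any m∉S)))
coeffVar-∈-Unique {m} (l ∷ S) (l∉S ∷ S-unique) (there m∈S) =
  trans (cong length (filter-reject (ℕ._≟ m) (All.lookup l∉S m∈S))) (coeffVar-∈-Unique S S-unique m∈S)

chenTerms : List ℕ → HComb → MComb
chenTerms ls = map (map₂ (chenMono ls))

chenTerms-prefixAll : ∀ l ls s xs → chenTerms (l ∷ ls) (prefixAll s xs) ≡ prefixAll (l ∷ ls , s) (chenTerms ls xs)
chenTerms-prefixAll l ls s xs = trans (sym (map-∘ xs)) (map-∘ xs)

∂mono-chenMono-∉ : ∀ {m} ls ss → m ∉ ls → ZeroCoeffs (∂mono m (chenMono ls ss))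
∂mono-chenMono-∉ [] ss m∉ = []
∂mono-chenMono-∉ (l ∷ ls) [] m∉ = []
∂mono-chenMono-∉ {m} (l ∷ ls) (s ∷ ss) m∉ =
  cong ι (trans (cong (s ℕ.*_) (coeffVar-∉ (l ∷ ls) m∉)) (*-zeroʳ s))
  ∷ ZeroCoeffs-prefixAll _ (∂mono-chenMono-∉ ls ss (m∉ ∘ there))

ι-*-coeffVar-lookup : ∀ {k} s (ls : Vec ℕ k) j → Unique (toList ls) →
  ι (s ℕ.* coeffVar (lookup ls j) (toList ls)) ≡ ι s
ι-*-coeffVar-lookup s ls j ls-unique =
  cong ι (trans (cong (s ℕ.*_) (coeffVar-∈-Unique _ ls-unique (∈-toList⁺ (∈-lookup j ls)))) (*-identityʳ s))

-- ∂mono keeps the terms j > i of the Leibniz sum, with coefficient 0; they make up zs.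
∂mono-chenMono-lookup : ∀ {k} (ls ss : Vec ℕ k) (j : Fin k) → Unique (toList ls) →
  ∃ λ zs → ZeroCoeffs zs ×
    ∂mono (lookup ls j) (chenMono (toList ls) (toList ss))
      ≡ chenTerms (toList ls) (bumps (suc (toℕ j)) (toList ss)) ++ zs
∂mono-chenMono-lookup (l ∷ ls) (s ∷ ss) Fin.zero unique@(l∉ls ∷ _) =
  zs , ZeroCoeffs-prefixAll _ (∂mono-chenMono-∉ (toList ls) (toList ss) (All¬⇒¬Any l∉ls))
     , cong (λ c → (c , (l ∷ toList ls , suc s) ∷ chenMono (toList ls) (toList ss)) ∷ zs)
            (ι-*-coeffVar-lookup s (l ∷ ls) Fin.zero unique)
  where
  zs : MComb
  zs = prefixAll (l ∷ toList ls , s) (∂mono l (chenMono (toList ls) (toList ss)))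
∂mono-chenMono-lookup (l ∷ ls) (s ∷ ss) (Fin.suc j) unique@(_ ∷ ls-unique)
  with ∂mono-chenMono-lookup ls ss j ls-unique
... | zs , zs-zero , ∂≡ = prefixAll factor zs , ZeroCoeffs-prefixAll factor zs-zero , (begin
    (ι (s ℕ.* coeffVar (lookup ls j) (l ∷ toList ls)) , bumped)
      ∷ prefixAll factor (∂mono (lookup ls j) (chenMono (toList ls) (toList ss)))
      ≡⟨ cong₂ (λ c t → (c , bumped) ∷ prefixAll factor t) (ι-*-coeffVar-lookup s (l ∷ ls) (Fin.suc j) unique) ∂≡ ⟩
    (ι s , bumped) ∷ prefixAll factor (chenTerms (toList ls) bs ++ zs)
      ≡⟨ cong ((ι s , bumped) ∷_) (map-++ _ (chenTerms (toList ls) bs) zs) ⟩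
    (ι s , bumped) ∷ prefixAll factor (chenTerms (toList ls) bs) ++ prefixAll factor zs
      ≡⟨ cong (λ t → (ι s , bumped) ∷ t ++ prefixAll factor zs) (chenTerms-prefixAll l (toList ls) s bs) ⟨
    chenTerms (l ∷ toList ls) (bumps (suc (suc (toℕ j))) (s ∷ toList ss)) ++ prefixAll factor zs ∎)
  where
  factor : LinForm × ℕ
  factor = (l ∷ toList ls , s)
  bumped : Mono
  bumped = (l ∷ toList ls , suc s) ∷ chenMono (toList ls) (toList ss)
  bs : HComb
  bs = bumps (suc (toℕ j)) (toList ss)

bumpsVec : ∀ {k} → ℕ → Vec ℕ k → List (ℚ × Vec ℕ k)
bumpsVec zero ss = []
bumpsVec (suc i) [] = []
bumpsVec (suc i) (s ∷ ss) = (ι s , suc s ∷ ss) ∷ map (map₂ (s ∷_)) (bumpsVec i ss)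

toList-bumpsVec : ∀ {k} i (ss : Vec ℕ k) → map (map₂ toList) (bumpsVec i ss) ≡ bumps i (toList ss)
toList-bumpsVec zero ss = refl
toList-bumpsVec (suc i) [] = refl
toList-bumpsVec (suc i) (s ∷ ss) = cong ((ι s , suc s ∷ toList ss) ∷_) (begin
  map (map₂ toList) (map (map₂ (s ∷_)) (bumpsVec i ss))   ≡⟨ trans (sym (map-∘ _)) (map-∘ _) ⟩
  prefixAll s (map (map₂ toList) (bumpsVec i ss))        ≡⟨ cong (prefixAll s) (toList-bumpsVec i ss) ⟩
  prefixAll s (bumps i (toList ss))                      ∎)

bumpsVec-positive : ∀ {k} i (ss : Vec ℕ k) → All (1 ≤_) (toList ss) →
  All (All (1 ≤_) ∘ toList ∘ proj₂) (bumpsVec i ss)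
bumpsVec-positive zero ss ss⁺ = []
bumpsVec-positive (suc i) [] ss⁺ = []
bumpsVec-positive (suc i) (s ∷ ss) (s⁺ ∷ ss⁺) =
  (ℕ.s≤s ℕ.z≤n ∷ ss⁺) ∷ map⁺ (All.map (s⁺ ∷_) (bumpsVec-positive i ss ss⁺))

chenComb : ∀ n → Vec ℕ (suc n) → List (ℚ × Vec ℕ (suc n)) → FComb
chenComb n ls = map (map₂ (chen n ls))

-- Both sides compute to [], since suc i ≤? 0 reduces to no.
πDerivEq-one : ∀ i → 1 ≤ i → πDerivEq i i ((1ℚ , one) ∷ [])
πDerivEq-one (suc i) _ = [] , [] , (λ _ → refl) , (λ _ → refl)

πDerivEq-chen-lookup : ∀ n (ls ss : Vec ℕ (suc n)) (j : Fin (suc n)) →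
  Unique (toList ls) → All (1 ≤_) (toList ls) → All (1 ≤_) (toList ss) →
  πDerivEq (lookup ls j) (suc (toℕ j)) ((1ℚ , chen n ls ss) ∷ [])
πDerivEq-chen-lookup n ls ss j ls-unique ls⁺ ss⁺ with ∂mono-chenMono-lookup ls ss j ls-unique
... | zs , zs-zero , ∂≡ = chenComb n ls bumped , valid , embed≈∂ , π≈δ
  where
  i : ℕ
  i = suc (toℕ j)
  bumped : List (ℚ × Vec ℕ (suc n))
  bumped = bumpsVec i ss
  terms : MComb
  terms = chenTerms (toList ls) (bumps i (toList ss))

  valid : All (ValidF ∘ proj₂) (chenComb n ls bumped)
  valid = map⁺ (All.map (λ ss′⁺ → ls-unique , ls⁺ , ss′⁺) (bumpsVec-positive i ss ss⁺))

  embed≡ : embed (chenComb n ls bumped) ≡ terms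
  embed≡ = begin
    embed (chenComb n ls bumped)                         ≡⟨ map-∘ bumped ⟨
    map (map₂ (chenMono (toList ls) ∘ toList)) bumped    ≡⟨ map-∘ bumped ⟩
    chenTerms (toList ls) (map (map₂ toList) bumped)     ≡⟨ cong (chenTerms (toList ls)) (toList-bumpsVec i ss) ⟩
    terms                                                ∎

  embed≈∂ : embed (chenComb n ls bumped) ≈M ∂ (lookup ls j) (embed ((1ℚ , chen n ls ss) ∷ []))
  embed≈∂ mo = begin
    coeffM (embed (chenComb n ls bumped)) mo                ≡⟨ cong (λ t → coeffM t mo) embed≡ ⟩
    coeffM terms mo                                         ≡⟨ ++-ZeroCoeffs-≈M terms zs-zero mo ⟨
    coeffM (terms ++ zs) mo                                 ≡⟨ cong (λ t → coeffM t mo) (trans (∂-1ℚ _ _) ∂≡) ⟨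
    coeffM (∂ (lookup ls j) (embed ((1ℚ , chen n ls ss) ∷ []))) mo  ∎

  i≤k : i ≤ length (toList ss)
  i≤k = subst (i ≤_) (sym (length-toList ss)) (toℕ<n j)

  π≈δ : π (chenComb n ls bumped) ≈H δ i (π ((1ℚ , chen n ls ss) ∷ []))
  π≈δ b = cong (λ t → coeffH t b) (begin
    π (chenComb n ls bumped)          ≡⟨ sym (map-∘ bumped) ⟩
    map (map₂ toList) bumped          ≡⟨ toList-bumpsVec i ss ⟩
    bumps i (toList ss)               ≡⟨ δB-≤ (toList ss) i≤k ⟨
    δB i (toList ss)                  ≡⟨ δ-1ℚ i (toList ss) ⟨
    δ i ((1ℚ , toList ss) ∷ [])       ∎)

πDerivEq-chen-∉ : ∀ n (ls ss : Vec ℕ (suc n)) i m → suc n < i → m ∉ toList ls →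
  πDerivEq m i ((1ℚ , chen n ls ss) ∷ [])
πDerivEq-chen-∉ n ls ss i m k<i m∉ls = [] , [] , ∂≈0 , δ≈0
  where
  ∂≈0 : [] ≈M ∂ m (embed ((1ℚ , chen n ls ss) ∷ []))
  ∂≈0 mo = sym (trans (cong (λ t → coeffM t mo) (∂-1ℚ m (chenMono (toList ls) (toList ss))))
                      (coeffM-ZeroCoeffs (∂mono-chenMono-∉ (toList ls) (toList ss) m∉ls) mo))

  i≰k : ¬ i ≤ length (toList ss)
  i≰k i≤k = <⇒≱ k<i (subst (i ≤_) (length-toList ss) i≤k)

  δ≈0 : [] ≈H δ i (π ((1ℚ , chen n ls ss) ∷ []))
  δ≈0 b = cong (λ t → coeffH t b) (sym (trans (δ-1ℚ i (toList ss)) (δB-≰ (toList ss) i≰k)))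

lemma4p9 :
    ((i : ℕ) → 1 ≤ i → πDerivEq i i ((1ℚ , one) ∷ []))
    × ((n : ℕ) (ls ss : Vec ℕ (suc n)) (i m : ℕ) →
        Unique (toList ls) → All (1 ≤_) (toList ls) → All (1 ≤_) (toList ss) →
        1 ≤ i → IndexSpec ls i m →
        πDerivEq m i ((1ℚ , chen n ls ss) ∷ []))
lemma4p9 = πDerivEq-one , πDerivEq-chen
  where
  πDerivEq-chen : ∀ n (ls ss : Vec ℕ (suc n)) i m →
    Unique (toList ls) → All (1 ≤_) (toList ls) → All (1 ≤_) (toList ss) →
    1 ≤ i → IndexSpec ls i m → πDerivEq m i ((1ℚ , chen n ls ss) ∷ [])
  πDerivEq-chen n ls ss _ _ ls-unique ls⁺ ss⁺ _ (inj₁ (j , refl , refl)) =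
    πDerivEq-chen-lookup n ls ss j ls-unique ls⁺ ss⁺
  πDerivEq-chen n ls ss i m _ _ _ _ (inj₂ (k<i , _ , m∉ls)) =
    πDerivEq-chen-∉ n ls ss i m k<i m∉ls
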